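{- Let $k\ge 2$ and $n\ge k+4$ be integers, and let $\mathcal{S}_{n,k}$ be the family of all $n$-vertex simple $k$-paths (up to isomorphism). If $U$ is a graph of treewidth $k$ that contains every graph of $\mathcal{S}$ as a subgraph, for some $\mathcal{S}\subseteq\mathcal{S}_{n,k}$, then $|V(U)|^2\ge|\mathcal{S}|$.
   Context: "$U$ contains $H$ as a subgraph" means $U$ has a subgraph isomorphic to $H$. A graph $G$ is a simple $k$-path if it has a path-decomposition $(X_1,\dots,X_m)$ (a sequence of vertex subsets covering $V(G)$, such that each edge lies in some $X_i$ and for each vertex the indices of bags containing it form an interval) such that: $|X_i|=k+1$ for all $i\in[m]$; $|X_i\cap X_{i+1}|=k$ for all $i\in[m-1]$; the sets $X_i\cap X_{i+1}$, $i\in[m-1]$, are pairwise distinct; and $G[X_i]$ is a clique for every $i\in[m]$. -}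

module Defs where

open import Data.Nat using (ℕ; zero; suc; _≤_; _<_; _*_)
open import Data.Fin using (Fin; toℕ; inject₁)
                     renaming (suc to fsuc)
open import Data.Fin.Subset using (Subset; _∈_; _∩_; ∣_∣)
open import Data.Bool using (Bool; true; false)
open import Data.List using (List; []; _∷_; _++_; length)
open import Data.List.Relation.Unary.Linked using (Linked)
open import Data.List.Relation.Unary.All using (All)
open import Data.List.Relation.Unary.AllPairs using (AllPairs)
open import Data.List.Relation.Unary.Unique.Propositional using (Unique)
open import Data.Product using (Σ; ∃; _×_; _,_)
open import Data.Unit using (⊤)
open import Relation.Nullary using (¬_)
open import Relation.Binary.PropositionalEquality using (_≡_; _≢_)
open import Function.Definitions using (Injective; Bijective)

record Graph (n : ℕ) : Set where
  field
    adj    : Fin n → Fin n → Bool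
    adj-sym    : ∀ u v → adj u v ≡ adj v u
    adj-irrefl : ∀ u → adj u u ≡ false
open Graph public

Adj : ∀ {n} → Graph n → Fin n → Fin n → Set
Adj G u v = adj G u v ≡ true

data ReachIn {n : ℕ} (G : Graph n) (P : Fin n → Set) : Fin n → Fin n → Set where
  here : ∀ {u} → P u → ReachIn G P u u
  step : ∀ {u w v} → P u → Adj G u w → ReachIn G P w v → ReachIn G P u v

Connected : ∀ {n} → Graph n → Set
Connected G = ∀ u v → ReachIn G (λ _ → ⊤) u v

HasCycle : ∀ {n} → Graph n → Set
HasCycle {n} G = Σ (Fin n) λ u → Σ (List (Fin n)) λ ws →
  (2 ≤ length ws) × Unique (u ∷ ws) × Linked (Adj G) (u ∷ ws ++ u ∷ [])

IsTree : ∀ {n} → Graph n → Set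
IsTree G = Connected G × ¬ HasCycle G

record TreeDecomposition {N : ℕ} (U : Graph N) (w : ℕ) : Set where
  field
    t     : ℕ
    T     : Graph (suc t)
    tree  : IsTree T
    bag   : Fin (suc t) → Subset N
    cover : ∀ v → Σ (Fin (suc t)) λ x → v ∈ bag x
    edge  : ∀ u v → Adj U u v → Σ (Fin (suc t)) λ x → (u ∈ bag x) × (v ∈ bag x)
    subtree : ∀ v x y → v ∈ bag x → v ∈ bag y → ReachIn T (λ z → v ∈ bag z) x y
    width : ∀ x → ∣ bag x ∣ ≤ suc w

TreewidthAtMost : ∀ {N} → Graph N → ℕ → Set
TreewidthAtMost U w = TreeDecomposition U w

Treewidth : ∀ {N} → Graph N → ℕ → Set
Treewidth U k = TreewidthAtMost U k × (∀ w → w < k → ¬ TreewidthAtMost U w)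

record SimpleKPathDecomposition {n : ℕ} (k : ℕ) (G : Graph n) : Set where
  field
    m     : ℕ
    X     : Fin (suc m) → Subset n
    cover : ∀ v → Σ (Fin (suc m)) λ i → v ∈ X i
    edge  : ∀ u v → Adj G u v → Σ (Fin (suc m)) λ i → (u ∈ X i) × (v ∈ X i)
    interval : ∀ v (i j l : Fin (suc m)) → toℕ i ≤ toℕ j → toℕ j ≤ toℕ l →
               v ∈ X i → v ∈ X l → v ∈ X j
    size  : ∀ i → ∣ X i ∣ ≡ suc k
    meet : ∀ (i : Fin m) → ∣ X (inject₁ i) ∩ X (fsuc i) ∣ ≡ k
    distinct : ∀ (i j : Fin m) → X (inject₁ i) ∩ X (fsuc i) ≡ X (inject₁ j) ∩ X (fsuc j) → i ≡ j
    clique : ∀ i u v → u ∈ X i → v ∈ X i → u ≢ v → Adj G u v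

IsSimpleKPath : ∀ {n} → ℕ → Graph n → Set
IsSimpleKPath k G = SimpleKPathDecomposition k G

Isomorphic : ∀ {n} → Graph n → Graph n → Set
Isomorphic {n} G H = Σ (Fin n → Fin n) λ f →
  Bijective _≡_ _≡_ f × (∀ u v → adj G u v ≡ adj H (f u) (f v))

ContainsSubgraph : ∀ {N n} → Graph N → Graph n → Set
ContainsSubgraph {N} {n} U H = Σ (Fin n → Fin N) λ f →
  Injective _≡_ _≡_ f × (∀ u v → Adj H u v → Adj U (f u) (f v))

{-# OPTIONS --safe #-}
-- Push the simple k-path decomposition of each G ∈ S along its embedding into U. This gives a chain
-- B₀, …, B_m of (k+1)-cliques of U in which consecutive cliques share k vertices and the separators
-- B_i ∩ B_{i+1} are pairwise distinct. In a tree decomposition of U of width k each B_i is a whole bag, so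
-- each separator is the adhesion of a tree edge, and in U it separates the vertices of B₀, …, B_i from
-- those of B_{i+1}, …, B_m. Using this, induction on i shows that the chain is determined by its two ends:
-- the vertex of B₀ outside B₁ and the vertex of B_m outside B_{m-1}. The chain determines G up to
-- isomorphism, so pairwise non-isomorphic members of S have distinct pairs of ends, and there are at
-- most |V(U)|² such pairs.

module Submission where

open import Defs
open import Data.Bool using (true)
open import Data.Bool.Properties using (⇔→≡) renaming (_≟_ to _≟ᵇ_)
open import Data.Empty using (⊥; ⊥-elim)
open import Data.Fin using (Fin; zero; suc; _≟_; toℕ; fromℕ<; inject₁; combine) renaming (_<_ to _<ᶠ_)
open import Data.Fin.Properties
  using (any?; suc-injective; toℕ-injective; toℕ-fromℕ<; toℕ-inject₁; toℕ≤pred[n]; pigeonhole; combine-injective)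
import Data.Fin.Subset
open import Data.Fin.Subset using (Subset; inside; outside; _∈_; _∉_; _⊆_; _∩_; _∪_; ⁅_⁆; _-_; ∣_∣) renaming (⊥ to ∅)
open import Data.Fin.Subset.Properties
  using (_∈?_; ∉⊥; x∈⁅x⁆; x∈⁅y⁆⇒x≡y; x∈p∪q⁺; x∈p∪q⁻; x∈p∩q⁺; x∈p∩q⁻; x∈p∧x≢y⇒x∈p-y; ∪-identityˡ; ∩-comm; ⊆-antisym;
         p⊆q⇒∣p∣≤∣q∣; p⊂q⇒∣p∣<∣q∣; x∈p⇒∣p-x∣<∣p∣; ∣⊥∣≡0; ∣⊤∣≡n)
open import Data.List using (List; []; _∷_; _++_; length; allFin; lookup)
open import Data.List.Membership.Propositional using () renaming (_∈_ to _∈ₗ_)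
open import Data.List.Membership.Propositional.Properties using (∈-allFin; ∈-lookup)
open import Data.List.Relation.Unary.All as All using (All; []; _∷_)
open import Data.List.Relation.Unary.All.Properties using (¬Any⇒All¬)
open import Data.List.Relation.Unary.AllPairs using (AllPairs; []; _∷_)
open import Data.List.Relation.Unary.Any as Any using (here; there)
open import Data.List.Relation.Unary.Linked using (Linked; [-]; _∷_)
open import Data.List.Relation.Unary.Unique.Propositional using (Unique)
open import Data.Nat
  using (ℕ; zero; suc; pred; _+_; _*_; _≤_; _<_; z≤n; s≤s; _≤′_; ≤′-refl; ≤′-step; _≤‴_; ≤‴-refl; ≤‴-step; >-nonZero)
open import Data.Nat.Properties
  using (≤-refl; ≤-reflexive; ≤-trans; <-trans; <-irrefl; <-≤-trans; <⇒≤; ≤-pred; <⇒≤pred; ≮⇒≥; <-cmp; n≤1+n; m<n⇒m<1+n;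
         m≤n⇒m<n∨m≡n; 1+n≢0; n≤0⇒n≡0; n≢0⇒n>0; suc-pred; +-comm; +-monoʳ-≤; ≤′⇒≤; ≤⇒≤′; ≤‴⇒≤; ≤⇒≤‴)
open import Data.Product using (Σ; ∃; ∃₂; _×_; _,_; proj₁; proj₂; uncurry; swap)
open import Data.Sum using (inj₁; inj₂)
open import Data.Unit using (⊤)
open import Data.Vec using ([]; _∷_; here; there)
open import Data.Vec.Properties using (≡-dec)
open import Function using (_∘_; flip)
open import Function.Bundles using (mk⇔)
open import Function.Consequences.Propositional
  using (inverseᵇ⇒bijective; strictlyInverseˡ⇒inverseˡ; strictlyInverseʳ⇒inverseʳ)
open import Function.Definitions using (Injective)
open import Relation.Binary.Definitions using (DecidableEquality; tri<; tri≈; tri>)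
open import Relation.Binary.PropositionalEquality
  using (_≡_; _≢_; refl; sym; trans; cong; cong₂; subst; subst₂; module ≡-Reasoning)
open import Relation.Nullary using (¬_; Dec; yes; no)
open import Relation.Nullary.Decidable using (_×-dec_; ¬?; decidable-stable; ¬¬-excluded-middle)
open import Relation.Nullary.Negation using (contradiction-irr)

Adj-sym : ∀ {n} (G : Graph n) {u v} → Adj G u v → Adj G v u
Adj-sym G {u} {v} u~v = trans (adj-sym G v u) u~v

Adj-irrefl : ∀ {n} (G : Graph n) {u v} → Adj G u v → u ≢ v
Adj-irrefl G {u} u~u refl with trans (sym u~u) (adj-irrefl G u)
... | ()

IsClique : ∀ {N} → Graph N → Subset N → Set
IsClique U K = ∀ {u v} → u ∈ K → v ∈ K → u ≢ v → Adj U u v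

clique-reach : ∀ {N} {U : Graph N} {K X : Subset N} → IsClique U K → ∀ {c v} → c ∈ K → v ∈ K → c ∉ X → v ∉ X →
               ReachIn U (_∉ X) c v
clique-reach K-clique {c} {v} c∈K v∈K c∉X v∉X with c ≟ v
... | yes refl = here c∉X
... | no c≢v   = step c∉X (K-clique c∈K v∈K c≢v) (here v∉X)

module _ {n : ℕ} {G : Graph n} where

  ReachIn-map : ∀ {P Q : Fin n → Set} → (∀ {x} → P x → Q x) → ∀ {u v} → ReachIn G P u v → ReachIn G Q u v
  ReachIn-map P⇒Q (here p)     = here (P⇒Q p)
  ReachIn-map P⇒Q (step p a r) = step (P⇒Q p) a (ReachIn-map P⇒Q r)

  first-entry : ∀ {Q : Fin n → Set} → (∀ x → Dec (Q x)) → ∀ {y w} → ReachIn G (λ _ → ⊤) y w → ¬ Q y → Q w →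
                ∃₂ λ c₁ c₂ → Adj G c₁ c₂ × ¬ Q c₁ × Q c₂ × ReachIn G (¬_ ∘ Q) y c₁
  first-entry Q? (here _) ¬Qy Qy = ⊥-elim (¬Qy Qy)
  first-entry Q? {y} (step {w = y′} _ a r) ¬Qy Qw with Q? y′
  ... | yes Qy′ = y , y′ , a , ¬Qy , Qy′ , here ¬Qy
  ... | no ¬Qy′ with first-entry Q? r ¬Qy′ Qw
  ...   | c₁ , c₂ , c₁~c₂ , ¬Qc₁ , Qc₂ , r′ = c₁ , c₂ , c₁~c₂ , ¬Qc₁ , Qc₂ , step ¬Qy a r′

  module _ {P : Fin n → Set} where

    ReachIn-head : ∀ {u v} → ReachIn G P u v → P u
    ReachIn-head (here p)     = p
    ReachIn-head (step p _ _) = p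

    ReachIn-++ : ∀ {u v w} → ReachIn G P u v → ReachIn G P v w → ReachIn G P u w
    ReachIn-++ (here _)     r′ = r′
    ReachIn-++ (step p a r) r′ = step p a (ReachIn-++ r r′)

    later : ∀ {u v} → ReachIn G P u v → List (Fin n)
    later (here _)              = []
    later (step {w = w} _ _ r) = w ∷ later r

    vertices : ∀ {u v} → ReachIn G P u v → List (Fin n)
    vertices {u} r = u ∷ later r

    vertices-All : ∀ {u v} (r : ReachIn G P u v) → All P (vertices r)
    vertices-All (here p)     = p ∷ []
    vertices-All (step p _ r) = p ∷ vertices-All r

    vertices-linked : ∀ {u v x} (r : ReachIn G P u v) → Adj G v x → Linked (Adj G) (vertices r ++ x ∷ [])
    vertices-linked (here _)     v~x = v~x ∷ [-]
    vertices-linked (step _ a r) v~x = a ∷ vertices-linked r v~x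

    vertices-length : ∀ {u v} → u ≢ v → (r : ReachIn G P u v) → 2 ≤ length (vertices r)
    vertices-length u≢v (here _)     = ⊥-elim (u≢v refl)
    vertices-length _   (step _ _ _) = s≤s (s≤s z≤n)

    suffix : ∀ {u v x} (r : ReachIn G P u v) → Unique (vertices r) → x ∈ₗ vertices r →
             Σ (ReachIn G P x v) λ r′ → Unique (vertices r′)
    suffix r            uq       (here refl)  = r , uq
    suffix (here _)     _        (there ())
    suffix (step _ _ r) (_ ∷ uq) (there x∈r) = suffix r uq x∈r

    shortcut : ∀ {u v} → ReachIn G P u v → Σ (ReachIn G P u v) λ r → Unique (vertices r)
    shortcut (here p) = here p , [] ∷ []
    shortcut {u} (step p a r) with shortcut r
    ... | r′ , uq with Any.any? (u ≟_) (vertices r′)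
    ...   | yes u∈r′ = suffix r′ uq u∈r′
    ...   | no  u∉r′ = step p a r′ , ¬Any⇒All¬ _ u∉r′ ∷ uq

acyclic⇒no-detour : ∀ {n} {G : Graph n} → ¬ HasCycle G → ∀ {z u u′} → Adj G z u → Adj G z u′ → u ≢ u′ →
                    ¬ ReachIn G (_≢ z) u u′
acyclic⇒no-detour {G = G} acyclic {z} z~u z~u′ u≢u′ r with shortcut r
... | r′ , uq =
  acyclic (z , vertices r′ , vertices-length u≢u′ r′ , z∉r′ ∷ uq , z~u ∷ vertices-linked r′ (Adj-sym G z~u′))
  where
  z∉r′ : All (z ≢_) (vertices r′)
  z∉r′ = All.map (λ x≢z z≡x → x≢z (sym z≡x)) (vertices-All r′)

-- When T is a tree: y lies on the z′-side of the edge z–z′.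
Side : ∀ {s} → Graph s → Fin s → Fin s → Fin s → Set
Side T z z′ y = ReachIn T (_≢ z) y z′

module _ {s : ℕ} {T : Graph s} where

  ¬Side-self : ∀ {z z′} → ¬ Side T z z′ z
  ¬Side-self r = ReachIn-head r refl

  Side-total : ∀ {z z′} → z ≢ z′ → ∀ {y} → ReachIn T (λ _ → ⊤) y z′ → ¬ Side T z z′ y → ¬ Side T z′ z y → ⊥
  Side-total z≢z′ (here _) ¬s _ = ¬s (here (z≢z′ ∘ sym))
  Side-total {z} {z′} z≢z′ {y} (step _ a r) ¬s ¬s′ with y ≟ z | y ≟ z′
  ... | yes refl | _        = ¬s′ (here z≢z′)
  ... | no _     | yes refl = ¬s (here (z≢z′ ∘ sym))
  ... | no y≢z   | no y≢z′  = Side-total z≢z′ r (¬s ∘ step y≢z a) (¬s′ ∘ step y≢z′ a)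

  module _ (acyclic : ¬ HasCycle T) {z z′ : Fin s} (z~z′ : Adj T z z′) where

    Side-cross : ∀ {P y y′} → ReachIn T P y y′ → Side T z z′ y → ¬ Side T z z′ y′ → P z × P z′
    Side-cross (here _) s ¬s = ⊥-elim (¬s s)
    Side-cross {y = y} (step {w = w} p a r) s ¬s with w ≟ z | y ≟ z′
    ... | no w≢z   | _        = Side-cross r (step w≢z (Adj-sym T a) s) ¬s
    ... | yes refl | yes refl = ReachIn-head r , p
    ... | yes refl | no y≢z′  = ⊥-elim (acyclic⇒no-detour acyclic (Adj-sym T a) z~z′ y≢z′ s)

    Side-exclusive : ∀ {y} → Side T z z′ y → ¬ Side T z′ z y
    Side-exclusive s s′ = proj₂ (Side-cross s′ s ¬Side-self) refl

descend : ∀ {P : ℕ → Set} {i} → (∀ {j} → j < i → P (suc j) → P j) → P i → ∀ {j} → j ≤ i → P j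
descend {P} {i} down Pi j≤i = go (≤⇒≤‴ j≤i)
  where
  go : ∀ {j} → j ≤‴ i → P j
  go ≤‴-refl          = Pi
  go (≤‴-step 1+j≤‴i) = down (≤‴⇒≤ 1+j≤‴i) (go 1+j≤‴i)

ascend : ∀ {P : ℕ → Set} {i m} → (∀ {j} → i ≤ j → j < m → P j → P (suc j)) → P i → ∀ {j} → i ≤ j → j ≤ m → P j
ascend {P} {i} {m} up Pi i≤j = go (≤⇒≤′ i≤j)
  where
  go : ∀ {j} → i ≤′ j → j ≤ m → P j
  go ≤′-refl         _     = Pi
  go (≤′-step i≤′j) 1+j≤m = up (≤′⇒≤ i≤′j) 1+j≤m (go i≤′j (<⇒≤ 1+j≤m))

-- P need not be decidable, hence the double negation.
first-failure : ∀ {P : ℕ → Set} {i m} → P i → i ≤ m → ¬ P m → ¬ ¬ ∃ λ j → i ≤ j × j < m × P j × ¬ P (suc j)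
first-failure {P} {i} Pi i≤m = go (≤⇒≤′ i≤m)
  where
  go : ∀ {m} → i ≤′ m → ¬ P m → ¬ ¬ ∃ λ j → i ≤ j × j < m × P j × ¬ P (suc j)
  go ≤′-refl ¬Pi _ = ¬Pi Pi
  go {suc m} (≤′-step i≤′m) ¬P1+m none = ¬¬-excluded-middle {A = P m} λ
    { (yes Pm) → none (m , ≤′⇒≤ i≤′m , ≤-refl , Pm , ¬P1+m)
    ; (no ¬Pm) → go i≤′m ¬Pm λ (j , i≤j , j<m , Pj , ¬P1+j) → none (j , i≤j , m<n⇒m<1+n j<m , Pj , ¬P1+j) }

_≟ₛ_ : ∀ {n} → DecidableEquality (Subset n)
_≟ₛ_ = ≡-dec _≟ᵇ_

module _ {n : ℕ} where

  p⊆q∧∣q∣≤∣p∣⇒q⊆p : ∀ {p q : Subset n} → p ⊆ q → ∣ q ∣ ≤ ∣ p ∣ → q ⊆ p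
  p⊆q∧∣q∣≤∣p∣⇒q⊆p {p} p⊆q ∣q∣≤∣p∣ {x} x∈q = decidable-stable (x ∈? p) λ x∉p →
    <-irrefl refl (<-≤-trans (p⊂q⇒∣p∣<∣q∣ (p⊆q , x , x∈q , x∉p)) ∣q∣≤∣p∣)

  ∣p∩q∣<∣p∣⇒p⊈q : ∀ {p q : Subset n} → ∣ p ∩ q ∣ < ∣ p ∣ → ¬ p ⊆ q
  ∣p∩q∣<∣p∣⇒p⊈q {p} {q} ∣p∩q∣<∣p∣ p⊆q =
    <-irrefl refl (<-≤-trans ∣p∩q∣<∣p∣ (p⊆q⇒∣p∣≤∣q∣ λ x∈p → x∈p∩q⁺ (x∈p , p⊆q x∈p)))

  ∣p∣≤1+∣p∩q∣⇒outside-unique : ∀ {p q : Subset n} → ∣ p ∣ ≤ suc ∣ p ∩ q ∣ →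
                                ∀ {x y} → x ∈ p → x ∉ q → y ∈ p → y ∉ q → x ≡ y
  ∣p∣≤1+∣p∩q∣⇒outside-unique {p} {q} ∣p∣≤ {x} {y} x∈p x∉q y∈p y∉q = decidable-stable (x ≟ y) λ x≢y →
    y∉q (proj₂ (x∈p∩q⁻ p q (p-x⊆p∩q (x∈p∧x≢y⇒x∈p-y y∈p (x≢y ∘ sym)))))
    where
    p∩q⊆p-x : p ∩ q ⊆ p - x
    p∩q⊆p-x z∈p∩q = let z∈p , z∈q = x∈p∩q⁻ p q z∈p∩q in
      x∈p∧x≢y⇒x∈p-y z∈p λ { refl → x∉q z∈q }
    p-x⊆p∩q : p - x ⊆ p ∩ q
    p-x⊆p∩q = p⊆q∧∣q∣≤∣p∣⇒q⊆p p∩q⊆p-x (≤-pred (<-≤-trans (x∈p⇒∣p-x∣<∣p∣ x∈p) ∣p∣≤))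

  module _ (p q : Subset n) where

    private
      outside? : Dec (∃ λ x → x ∈ p × x ∉ q)
      outside? = any? λ x → x ∈? p ×-dec ¬? (x ∈? q)

    p⊈q⇒∃ : ¬ p ⊆ q → ∃ λ x → x ∈ p × x ∉ q
    p⊈q⇒∃ p⊈q with outside?
    ... | yes found = found
    ... | no none   = ⊥-elim (p⊈q λ {x} x∈p → decidable-stable (x ∈? q) λ x∉q → none (x , x∈p , x∉q))

    -- The witness only depends on p and q, not on the (irrelevant) proof that one exists.
    pick : .(¬ p ⊆ q) → Fin n
    pick p⊈q with outside?
    ... | yes (x , _) = x
    ... | no none     = contradiction-irr p⊈q (none ∘ p⊈q⇒∃)

    pick-spec : (p⊈q : ¬ p ⊆ q) → pick p⊈q ∈ p × pick p⊈q ∉ q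
    pick-spec p⊈q with outside?
    ... | yes (_ , x∈p , x∉q) = x∈p , x∉q
    ... | no none             = ⊥-elim (none (p⊈q⇒∃ p⊈q))

∣⁅x⁆∪p∣≡1+∣p∣ : ∀ {n} (x : Fin n) (p : Subset n) → x ∉ p → ∣ ⁅ x ⁆ ∪ p ∣ ≡ suc ∣ p ∣
∣⁅x⁆∪p∣≡1+∣p∣ zero    (inside ∷ p)  x∉p = ⊥-elim (x∉p here)
∣⁅x⁆∪p∣≡1+∣p∣ zero    (outside ∷ p) _   = cong (suc ∘ ∣_∣) (∪-identityˡ p)
∣⁅x⁆∪p∣≡1+∣p∣ (suc x) (inside ∷ p)  x∉p = cong suc (∣⁅x⁆∪p∣≡1+∣p∣ x p (x∉p ∘ there))
∣⁅x⁆∪p∣≡1+∣p∣ (suc x) (outside ∷ p) x∉p = ∣⁅x⁆∪p∣≡1+∣p∣ x p (x∉p ∘ there)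

image : ∀ {n N} → (Fin n → Fin N) → Subset n → Subset N
image f []            = ∅
image f (outside ∷ p) = image (f ∘ suc) p
image f (inside ∷ p)  = ⁅ f zero ⁆ ∪ image (f ∘ suc) p

module _ {N : ℕ} where

  image⁺ : ∀ {n} (f : Fin n → Fin N) {p u} → u ∈ p → f u ∈ image f p
  image⁺ f {inside ∷ p}  here        = x∈p∪q⁺ (inj₁ (x∈⁅x⁆ (f zero)))
  image⁺ f {inside ∷ p}  (there u∈p) = x∈p∪q⁺ (inj₂ (image⁺ (f ∘ suc) u∈p))
  image⁺ f {outside ∷ p} (there u∈p) = image⁺ (f ∘ suc) u∈p

  image⁻ : ∀ {n} (f : Fin n → Fin N) p {y} → y ∈ image f p → ∃ λ u → u ∈ p × f u ≡ y
  image⁻ f [] y∈ = ⊥-elim (∉⊥ y∈)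
  image⁻ f (outside ∷ p) y∈ with image⁻ (f ∘ suc) p y∈
  ... | u , u∈p , refl = suc u , there u∈p , refl
  image⁻ f (inside ∷ p) y∈ with x∈p∪q⁻ ⁅ f zero ⁆ _ y∈
  ... | inj₁ y∈⁅f0⁆ = zero , here , sym (x∈⁅y⁆⇒x≡y _ y∈⁅f0⁆)
  ... | inj₂ y∈rest with image⁻ (f ∘ suc) p y∈rest
  ...   | u , u∈p , refl = suc u , there u∈p , refl

  ∣image∣ : ∀ {n} {f : Fin n → Fin N} → Injective _≡_ _≡_ f → ∀ p → ∣ image f p ∣ ≡ ∣ p ∣
  ∣image∣ f-inj []            = ∣⊥∣≡0 N
  ∣image∣ f-inj (outside ∷ p) = ∣image∣ (suc-injective ∘ f-inj) p
  ∣image∣ {f = f} f-inj (inside ∷ p) =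
    trans (∣⁅x⁆∪p∣≡1+∣p∣ (f zero) _ f0∉) (cong suc (∣image∣ (suc-injective ∘ f-inj) p))
    where
    f0∉ : f zero ∉ image (f ∘ suc) p
    f0∉ f0∈ with image⁻ (f ∘ suc) p f0∈
    ... | _ , _ , eq with f-inj eq
    ...   | ()

  module _ {n} {f : Fin n → Fin N} (f-inj : Injective _≡_ _≡_ f) where

    image-reflects-∈ : ∀ p {u} → f u ∈ image f p → u ∈ p
    image-reflects-∈ p fu∈ with image⁻ f p fu∈
    ... | _ , u∈p , fu≡fu′ = subst (_∈ _) (f-inj fu≡fu′) u∈p

    image-∩ : ∀ p q → image f (p ∩ q) ≡ image f p ∩ image f q
    image-∩ p q = ⊆-antisym image⊆ image⊇
      where
      image⊆ : image f (p ∩ q) ⊆ image f p ∩ image f q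
      image⊆ y∈ with image⁻ f (p ∩ q) y∈
      ... | u , u∈p∩q , refl = let u∈p , u∈q = x∈p∩q⁻ p q u∈p∩q in x∈p∩q⁺ (image⁺ f u∈p , image⁺ f u∈q)
      image⊇ : image f p ∩ image f q ⊆ image f (p ∩ q)
      image⊇ y∈ with x∈p∩q⁻ (image f p) (image f q) y∈
      ... | y∈p , y∈q with image⁻ f p y∈p
      ...   | u , u∈p , refl = image⁺ f (x∈p∩q⁺ (u∈p , image-reflects-∈ q y∈q))

    image-injective : ∀ {p q} → image f p ≡ image f q → p ≡ q
    image-injective {p} {q} eq = ⊆-antisym (λ u∈p → image-reflects-∈ q (subst (_ ∈_) eq (image⁺ f u∈p)))
                                           (λ u∈q → image-reflects-∈ p (subst (_ ∈_) (sym eq) (image⁺ f u∈q)))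

-- The bags X₀, …, X_m of a simple k-path decomposition, indexed by ℕ and carried into U; bags beyond m
-- are only required to be cliques.
record CliqueChain {N : ℕ} (U : Graph N) (k : ℕ) : Set where
  field
    m          : ℕ
    B          : ℕ → Subset N
    size       : ∀ {i} → i ≤ m → ∣ B i ∣ ≡ suc k
    meet       : ∀ {i} → i < m → ∣ B i ∩ B (suc i) ∣ ≡ k
    distinct   : ∀ {i j} → i < m → j < m → B i ∩ B (suc i) ≡ B j ∩ B (suc j) → i ≡ j
    interval   : ∀ {v i j l} → i ≤ j → j ≤ l → l ≤ m → v ∈ B i → v ∈ B l → v ∈ B j
    clique     : ∀ i → IsClique U (B i)
    nontrivial : 0 < m

module ChainProperties {N : ℕ} {U : Graph N} {k : ℕ} (C : CliqueChain U k) where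
  open CliqueChain C public

  sep : ℕ → Subset N
  sep i = B i ∩ B (suc i)

  sep-injective : ∀ {i j} → j < m → i < m → sep j ⊆ sep i → j ≡ i
  sep-injective {i} {j} j<m i<m sepj⊆sepi = distinct j<m i<m (⊆-antisym sepj⊆sepi sepi⊆sepj)
    where
    sepi⊆sepj : sep i ⊆ sep j
    sepi⊆sepj = p⊆q∧∣q∣≤∣p∣⇒q⊆p sepj⊆sepi (≤-reflexive (trans (meet i<m) (sym (meet j<m))))

  private
    ∣B∣≡1+∣sep∣ : ∀ {i} → i < m → ∣ B i ∣ ≡ suc ∣ sep i ∣
    ∣B∣≡1+∣sep∣ i<m = trans (size (<⇒≤ i<m)) (cong suc (sym (meet i<m)))

    ∣next∣≡1+∣sep∣ : ∀ {i} → i < m → ∣ B (suc i) ∣ ≡ suc ∣ B (suc i) ∩ B i ∣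
    ∣next∣≡1+∣sep∣ {i} i<m = begin
      ∣ B (suc i) ∣             ≡⟨ size i<m ⟩
      suc k                     ≡⟨ cong suc (sym (meet i<m)) ⟩
      suc ∣ B i ∩ B (suc i) ∣   ≡⟨ cong (suc ∘ ∣_∣) (∩-comm (B i) (B (suc i))) ⟩
      suc ∣ B (suc i) ∩ B i ∣   ∎
      where open ≡-Reasoning

    B⊈next : ∀ {i} → i < m → ¬ B i ⊆ B (suc i)
    B⊈next i<m = ∣p∩q∣<∣p∣⇒p⊈q (≤-reflexive (sym (∣B∣≡1+∣sep∣ i<m)))

    next⊈B : ∀ {i} → i < m → ¬ B (suc i) ⊆ B i
    next⊈B i<m = ∣p∩q∣<∣p∣⇒p⊈q (≤-reflexive (sym (∣next∣≡1+∣sep∣ i<m)))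

  leaving : ∀ i → .(i < m) → Fin N
  leaving i i<m = pick (B i) (B (suc i)) (B⊈next i<m)

  entering : ∀ i → .(i < m) → Fin N
  entering i i<m = pick (B (suc i)) (B i) (next⊈B i<m)

  module _ {i : ℕ} (i<m : i < m) where

    leaving∈ : leaving i i<m ∈ B i
    leaving∈ = proj₁ (pick-spec _ _ (B⊈next i<m))

    leaving∉ : leaving i i<m ∉ B (suc i)
    leaving∉ = proj₂ (pick-spec _ _ (B⊈next i<m))

    entering∈ : entering i i<m ∈ B (suc i)
    entering∈ = proj₁ (pick-spec _ _ (next⊈B i<m))

    entering∉ : entering i i<m ∉ B i
    entering∉ = proj₂ (pick-spec _ _ (next⊈B i<m))

    leaving∉sep : leaving i i<m ∉ sep i
    leaving∉sep = leaving∉ ∘ proj₂ ∘ x∈p∩q⁻ (B i) (B (suc i))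

    leaving-unique : ∀ {v} → v ∈ B i → v ∉ B (suc i) → v ≡ leaving i i<m
    leaving-unique v∈ v∉ = ∣p∣≤1+∣p∩q∣⇒outside-unique (≤-reflexive (∣B∣≡1+∣sep∣ i<m)) v∈ v∉ leaving∈ leaving∉

    entering-unique : ∀ {v} → v ∈ B (suc i) → v ∉ B i → v ≡ entering i i<m
    entering-unique v∈ v∉ = ∣p∣≤1+∣p∩q∣⇒outside-unique (≤-reflexive (∣next∣≡1+∣sep∣ i<m)) v∈ v∉ entering∈ entering∉

    stays : ∀ {v} → v ∈ B i → v ≢ leaving i i<m → v ∈ B (suc i)
    stays v∈ v≢ = decidable-stable (_ ∈? B (suc i)) (v≢ ∘ leaving-unique v∈)

    ∈sep : ∀ {v} → v ∈ B i → v ≢ leaving i i<m → v ∈ sep i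
    ∈sep v∈ v≢ = x∈p∩q⁺ (v∈ , stays v∈ v≢)

    stayed : ∀ {v} → v ∈ B (suc i) → v ≢ entering i i<m → v ∈ B i
    stayed v∈ v≢ = decidable-stable (_ ∈? B i) (v≢ ∘ entering-unique v∈)

  leaving≢entering : ∀ {i} (1+i<m : suc i < m) → leaving (suc i) 1+i<m ≢ entering i (<⇒≤ 1+i<m)
  leaving≢entering {i} 1+i<m same = <-irrefl refl (≤-reflexive (sym (sep-injective i<m 1+i<m sepi⊆sep1+i)))
    where
    i<m : i < m
    i<m = <⇒≤ 1+i<m
    sepi⊆sep1+i : sep i ⊆ sep (suc i)
    sepi⊆sep1+i v∈ = let v∈Bi , v∈B1+i = x∈p∩q⁻ (B i) (B (suc i)) v∈ in
      ∈sep 1+i<m v∈B1+i λ { refl → entering∉ i<m (subst (_∈ B i) same v∈Bi) }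

  start : Fin N
  start = leaving 0 nontrivial

  private
    pred-m<m : pred m < m
    pred-m<m = ≤-reflexive (suc-pred m {{>-nonZero nontrivial}})

  end : Fin N
  end = entering (pred m) pred-m<m

  entering-cong : ∀ {i j} → i ≡ j → .(i<m : i < m) .(j<m : j < m) → entering i i<m ≡ entering j j<m
  entering-cong refl _ _ = refl

  entering-last : ∀ {i} .(i<m : i < m) → suc i ≡ m → entering i i<m ≡ end
  entering-last i<m 1+i≡m = entering-cong (cong pred 1+i≡m) i<m pred-m<m

  end∈ : end ∈ B m
  end∈ = subst (λ j → end ∈ B j) (suc-pred m {{>-nonZero nontrivial}}) (entering∈ pred-m<m)

  end∉ : ∀ {j} → j < m → end ∉ B j
  end∉ j<m end∈Bj = entering∉ pred-m<m (interval (<⇒≤pred j<m) (<⇒≤ pred-m<m) ≤-refl end∈Bj end∈)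

module TreeDecompositionProperties {N w : ℕ} {U : Graph N} (TD : TreeDecomposition U w) where
  open TreeDecomposition TD

  Node : Set
  Node = Fin (suc t)

  connected : Connected T
  connected = proj₁ tree

  acyclic : ¬ HasCycle T
  acyclic = proj₂ tree

  bags-cross : ∀ {z z′} → Adj T z z′ → ∀ {v y y′} → Side T z z′ y → ¬ Side T z z′ y′ →
               v ∈ bag y → v ∈ bag y′ → v ∈ bag z × v ∈ bag z′
  bags-cross z~z′ s ¬s v∈y v∈y′ = Side-cross acyclic z~z′ (subtree _ _ _ v∈y v∈y′) s ¬s

  Confined : Node → Node → Fin N → Set
  Confined z z′ v = ∀ {y} → v ∈ bag y → ¬ Side T z z′ y

  adhesion-separates : ∀ {z z′} → Adj T z z′ → ∀ {u u′} → ReachIn U (λ v → ¬ (v ∈ bag z × v ∈ bag z′)) u u′ →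
                       Confined z z′ u → Confined z z′ u′
  adhesion-separates z~z′ (here _) u-confined = u-confined
  adhesion-separates z~z′ (step {u = u} {w = w} _ u~w r) u-confined = adhesion-separates z~z′ r w-confined
    where
    w-confined : Confined _ _ w
    w-confined w∈y s with edge u w u~w
    ... | d , u∈d , w∈d = ReachIn-head r (bags-cross z~z′ s (u-confined u∈d) w∈y w∈d)

  clique-in-bag : ∀ {K} → IsClique U K → ∃ λ x → K ⊆ bag x
  clique-in-bag {K} K-clique = let x , covered = go (allFin N) in x , covered (∈-allFin _)
    where
    go : ∀ xs → ∃ λ x → ∀ {v} → v ∈ₗ xs → v ∈ K → v ∈ bag x
    go [] = zero , λ ()
    go (v ∷ xs) with go xs
    ... | y , xs⊆y with v ∈? K
    ...   | no v∉K = y , λ { (here refl) v∈K → ⊥-elim (v∉K v∈K) ; (there u∈xs) → xs⊆y u∈xs }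
    ...   | yes v∈K with v ∈? bag y
    ...     | yes v∈y = y , λ { (here refl) _ → v∈y ; (there u∈xs) → xs⊆y u∈xs }
    ...     | no v∉y with cover v
    ...       | x , v∈x with first-entry (λ c → v ∈? bag c) (connected y x) v∉y v∈x
    ...         | c₁ , c₂ , c₁~c₂ , v∉c₁ , v∈c₂ , y⇝c₁ =
                  c₂ , λ { (here refl) _ → v∈c₂ ; (there u∈xs) u∈K → moved u∈xs u∈K }
      where
      c₂~c₁ : Adj T c₂ c₁
      c₂~c₁ = Adj-sym T c₁~c₂
      y-side : Side T c₂ c₁ y
      y-side = ReachIn-map (λ v∉c c≡c₂ → v∉c (subst (λ c → v ∈ bag c) (sym c≡c₂) v∈c₂)) y⇝c₁
      moved : ∀ {u} → u ∈ₗ xs → u ∈ K → u ∈ bag c₂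
      moved {u} u∈xs u∈K with u ≟ v
      ... | yes refl = v∈c₂
      ... | no u≢v with edge u v (K-clique u∈K v∈K u≢v)
      ...   | d , u∈d , v∈d = proj₁ (bags-cross c₂~c₁ y-side ¬d-side (xs⊆y u∈xs u∈K) u∈d)
        where
        ¬d-side : ¬ Side T c₂ c₁ d
        ¬d-side s = v∉c₁ (proj₂ (bags-cross c₂~c₁ s ¬Side-self v∈d v∈c₂))

module Separation {N k : ℕ} {U : Graph N} (TD : TreeDecomposition U k) (C : CliqueChain U k) where
  open TreeDecomposition TD
  open TreeDecompositionProperties TD
  open ChainProperties C

  hull : ℕ → Node
  hull j = proj₁ (clique-in-bag (clique j))

  B⊆hull : ∀ j → B j ⊆ bag (hull j)
  B⊆hull j = proj₂ (clique-in-bag (clique j))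

  bag⊇B⇒bag⊆B : ∀ {j x} → j ≤ m → B j ⊆ bag x → bag x ⊆ B j
  bag⊇B⇒bag⊆B {j} {x} j≤m B⊆x = p⊆q∧∣q∣≤∣p∣⇒q⊆p B⊆x (subst (∣ bag x ∣ ≤_) (sym (size j≤m)) (width x))

  sep⊆hulls : ∀ {j v} → v ∈ sep j → v ∈ bag (hull j) × v ∈ bag (hull (suc j))
  sep⊆hulls {j} v∈ = let v∈j , v∈1+j = x∈p∩q⁻ (B j) (B (suc j)) v∈ in B⊆hull j v∈j , B⊆hull (suc j) v∈1+j

  record SeparatingEdge (i : ℕ) : Set where
    field
      z z′      : Node
      z~z′      : Adj T z z′
      adhesion⊆ : ∀ {v} → v ∈ bag z → v ∈ bag z′ → v ∈ sep i
      ¬before   : ¬ Side T z z′ (hull i)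
      ¬after    : ¬ Side T z′ z (hull (suc i))

  module _ {i : ℕ} (i<m : i < m) where

    private
      ρ : Fin N
      ρ = leaving i i<m

      ρ∈hull : ρ ∈ bag (hull i)
      ρ∈hull = B⊆hull i (leaving∈ i<m)

      ρ∉hull : ρ ∉ bag (hull (suc i))
      ρ∉hull = leaving∉ i<m ∘ bag⊇B⇒bag⊆B i<m (B⊆hull (suc i))

    -- Take the tree edge through which the path from hull (1+i) first enters the subtree of bags holding ρ.
    separating-edge : SeparatingEdge i
    separating-edge with first-entry (λ x → ρ ∈? bag x) (connected (hull (suc i)) (hull i)) ρ∉hull ρ∈hull
    ... | z′ , z , z′~z , ρ∉z′ , ρ∈z , after⇝z′ = record
      { z = z ; z′ = z′ ; z~z′ = z~z′ ; adhesion⊆ = adhesion⊆ ; ¬before = ¬before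
      ; ¬after = Side-exclusive acyclic z~z′ after }
      where
      z~z′ = Adj-sym T z′~z
      after : Side T z z′ (hull (suc i))
      after = ReachIn-map (λ ρ∉x x≡z → ρ∉x (subst (λ x → ρ ∈ bag x) (sym x≡z) ρ∈z)) after⇝z′
      ¬before : ¬ Side T z z′ (hull i)
      ¬before s = ρ∉z′ (proj₂ (bags-cross z~z′ s ¬Side-self ρ∈hull ρ∈z))
      B⊆z : B i ⊆ bag z
      B⊆z {v} v∈B with v ≟ ρ
      ... | yes refl = ρ∈z
      ... | no v≢ρ   = proj₁ (bags-cross z~z′ after ¬before (B⊆hull (suc i) (stays i<m v∈B v≢ρ)) (B⊆hull i v∈B))
      adhesion⊆ : ∀ {v} → v ∈ bag z → v ∈ bag z′ → v ∈ sep i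
      adhesion⊆ v∈z v∈z′ = ∈sep i<m (bag⊇B⇒bag⊆B (<⇒≤ i<m) B⊆z v∈z) λ { refl → ρ∉z′ v∈z′ }

  separation : ∀ {i j j′ l r} → i < m → j ≤ i → i < j′ → j′ ≤ m → l ∈ B j → r ∈ B j′ → ¬ ReachIn U (_∉ sep i) l r
  separation {i} {j} {j′} {l} {r} i<m j≤i i<j′ j′≤m l∈B r∈B l⇝r =
    Side-total (Adj-irrefl T z~z′) (connected (hull j′) z′) (r-confined (B⊆hull j′ r∈B)) (after i<j′ j′≤m)
    where
    open SeparatingEdge (separating-edge i<m)
    crossing-index : ∀ {a b j y y′} → Adj T a b → (∀ {v} → v ∈ bag a → v ∈ bag b → v ∈ sep i) → j < m →
                     Side T a b y → ¬ Side T a b y′ → (∀ {v} → v ∈ sep j → v ∈ bag y × v ∈ bag y′) → j ≡ i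
    crossing-index a~b adhesion⊆sep j<m s ¬s sep⊆ =
      sep-injective j<m i<m (uncurry adhesion⊆sep ∘ uncurry (bags-cross a~b s ¬s) ∘ sep⊆)
    before : ∀ {j} → j ≤ i → ¬ Side T z z′ (hull j)
    before = descend (λ j<i ¬s s →
      <-irrefl (crossing-index z~z′ adhesion⊆ (<-trans j<i i<m) s ¬s sep⊆hulls) j<i) ¬before
    after : ∀ {j} → i < j → j ≤ m → ¬ Side T z′ z (hull j)
    after = ascend (λ i<j j<m ¬s s →
      <-irrefl (sym (crossing-index (Adj-sym T z~z′) (flip adhesion⊆) j<m s ¬s (swap ∘ sep⊆hulls))) i<j) ¬after
    l-confined : Confined z z′ l
    l-confined l∈y s = ReachIn-head l⇝r (uncurry adhesion⊆ (bags-cross z~z′ s (before j≤i) l∈y (B⊆hull j l∈B)))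
    r-confined : Confined z z′ r
    r-confined = adhesion-separates z~z′ (ReachIn-map (_∘ uncurry adhesion⊆) l⇝r) l-confined

module _ {N k : ℕ} {U : Graph N} (C : CliqueChain U k) where
  open ChainProperties C

  chain-meets-separator : ∀ {X c i e} → ∣ X ∣ ≤ k → i ≤ m → c ∈ B i → c ∉ X → e ∈ B m → e ∉ X →
                          ¬ ReachIn U (_∉ X) c e → ¬ ¬ ∃ λ j → i ≤ j × j < m × sep j ≡ X
  chain-meets-separator {X} {c} {i} ∣X∣≤k i≤m c∈B c∉X e∈B e∉X c↛e found =
    first-failure {P} (λ v∈ v∉ → clique-reach (clique i) c∈B v∈ c∉X v∉) i≤m (λ Pm → c↛e (Pm e∈B e∉X))
      λ (j , i≤j , j<m , Pj , ¬P1+j) → found (j , i≤j , j<m , sep≡X j<m Pj ¬P1+j)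
    where
    P : ℕ → Set
    P j = ∀ {v} → v ∈ B j → v ∉ X → ReachIn U (_∉ X) c v
    sep≡X : ∀ {j} → j < m → P j → ¬ P (suc j) → sep j ≡ X
    sep≡X {j} j<m Pj ¬P1+j = ⊆-antisym sep⊆X (p⊆q∧∣q∣≤∣p∣⇒q⊆p sep⊆X (subst (∣ X ∣ ≤_) (sym (meet j<m)) ∣X∣≤k))
      where
      sep⊆X : sep j ⊆ X
      sep⊆X {v} v∈sep = decidable-stable (v ∈? X) λ v∉X →
        let v∈j , v∈1+j = x∈p∩q⁻ (B j) (B (suc j)) v∈sep in
        ¬P1+j λ x∈ x∉ → ReachIn-++ (Pj v∈j v∉X) (clique-reach (clique (suc j)) v∈1+j x∈ v∉X x∉)

module TwoChains {N k : ℕ} {U : Graph N} (X Y : CliqueChain U k) where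
  module X = ChainProperties X
  module Y = ChainProperties Y

  bag-from-sep : ∀ {i j} (i<m : i < X.m) (j<m : j < Y.m) → X.leaving i i<m ≡ Y.leaving j j<m → X.sep i ≡ Y.sep j →
                 X.B i ⊆ Y.B j
  bag-from-sep i<m j<m ρ≡ sep≡ {v} v∈ with v ≟ X.leaving _ i<m
  ... | yes refl = subst (_∈ _) (sym ρ≡) (Y.leaving∈ j<m)
  ... | no v≢ρ   = proj₁ (x∈p∩q⁻ _ _ (subst (v ∈_) sep≡ (X.∈sep i<m v∈ v≢ρ)))

  module _ {i} (i<mX : i < X.m) (i<mY : i < Y.m) (B≡ : X.B i ≡ Y.B i)
           (ρ≡ : X.leaving i i<mX ≡ Y.leaving i i<mY) where

    next-bag-transfer : ∀ {v} → v ∈ X.B (suc i) → v ≢ X.entering i i<mX → v ∈ Y.B (suc i)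
    next-bag-transfer v∈ v≢ = Y.stays i<mY (subst (_ ∈_) B≡ (X.stayed i<mX v∈ v≢))
                                           λ v≡ → X.leaving∉ i<mX (subst (_∈ X.B (suc i)) (trans v≡ (sym ρ≡)) v∈)

    next-bag⊆ : X.entering i i<mX ≡ Y.entering i i<mY → X.B (suc i) ⊆ Y.B (suc i)
    next-bag⊆ q≡ {v} v∈ with v ≟ X.entering i i<mX
    ... | yes refl = subst (_∈ _) (sym q≡) (Y.entering∈ i<mY)
    ... | no v≢q   = next-bag-transfer v∈ v≢q

module SameEnds {N k : ℕ} {U : Graph N} (TD : TreeDecomposition U k) (X Y : CliqueChain U k)
                (same-start : ChainProperties.start X ≡ ChainProperties.start Y)
                (same-end : ChainProperties.end X ≡ ChainProperties.end Y) where
  open TwoChains X Y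
  open Separation TD X using () renaming (separation to X-separation)
  open Separation TD Y using () renaming (separation to Y-separation)

  -- From c the chain Y reaches the common end, which X.sep s separates from c.
  X-sep-in-Y : ∀ {s s′ c} (s<m : s < X.m) → c ∈ X.B s → c ∉ X.sep s → s′ ≤ Y.m → c ∈ Y.B s′ →
               ¬ ¬ ∃ λ j → s′ ≤ j × j < Y.m × Y.sep j ≡ X.sep s
  X-sep-in-Y {s} s<m c∈X c∉ s′≤m c∈Y =
    chain-meets-separator Y (≤-reflexive (X.meet s<m)) s′≤m c∈Y c∉ Y.end∈ end∉
      λ c⇝end → X-separation s<m ≤-refl s<m ≤-refl c∈X X.end∈ (subst (ReachIn U _ _) (sym same-end) c⇝end)
    where
    end∉ : Y.end ∉ X.sep s
    end∉ = X.end∉ s<m ∘ subst (_∈ X.B s) (sym same-end) ∘ proj₁ ∘ x∈p∩q⁻ _ _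

  first-bags-agree : X.B 0 ≡ Y.B 0
  first-bags-agree = decidable-stable (X.B 0 ≟ₛ Y.B 0) λ B≢ →
    X-sep-in-Y X.nontrivial (X.leaving∈ X.nontrivial) (X.leaving∉sep X.nontrivial) z≤n a∈Y (contra B≢)
    where
    a : Fin N
    a = X.start
    a∈Y : a ∈ Y.B 0
    a∈Y = subst (_∈ Y.B 0) (sym same-start) (Y.leaving∈ Y.nontrivial)
    a∉Ysep : a ∉ Y.sep 0
    a∉Ysep = subst (_∉ Y.sep 0) (sym same-start) (Y.leaving∉sep Y.nontrivial)
    contra : X.B 0 ≢ Y.B 0 → ¬ ∃ λ j → 0 ≤ j × j < Y.m × Y.sep j ≡ X.sep 0
    contra B≢ (zero , _ , _ , sep≡) =
      B≢ (⊆-antisym (bag-from-sep X.nontrivial Y.nontrivial same-start (sym sep≡))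
                    (TwoChains.bag-from-sep Y X Y.nontrivial X.nontrivial (sym same-start) sep≡))
    contra _ (suc j , _ , j<m , sep≡)
      with p⊈q⇒∃ (Y.sep (suc j)) (Y.sep 0) (1+n≢0 ∘ Y.sep-injective j<m Y.nontrivial)
    ... | v , v∈Ysep , v∉Ysep =
      Y-separation Y.nontrivial z≤n (s≤s z≤n) (<⇒≤ j<m) a∈Y (proj₁ (x∈p∩q⁻ _ _ v∈Ysep))
        (step a∉Ysep (X.clique 0 (X.leaving∈ X.nontrivial) (proj₁ (x∈p∩q⁻ _ _ v∈Xsep)) a≢v) (here v∉Ysep))
      where
      v∈Xsep : v ∈ X.sep 0
      v∈Xsep = subst (v ∈_) sep≡ v∈Ysep
      a≢v : a ≢ v
      a≢v refl = X.leaving∉sep X.nontrivial v∈Xsep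

  leaving-agrees : ∀ {i} (i<mX : i < X.m) (i<mY : i < Y.m) → X.B i ≡ Y.B i →
                   X.leaving i i<mX ≡ Y.leaving i i<mY
  leaving-agrees {i} i<mX i<mY B≡ = decidable-stable (ρ ≟ ρ′) λ ρ≢ρ′ →
    X-sep-in-Y i<mX (X.leaving∈ i<mX) (X.leaving∉sep i<mX) (<⇒≤ i<mY) ρ∈Y (contra ρ≢ρ′)
    where
    ρ ρ′ : Fin N
    ρ = X.leaving i i<mX
    ρ′ = Y.leaving i i<mY
    ρ∈Y : ρ ∈ Y.B i
    ρ∈Y = subst (ρ ∈_) B≡ (X.leaving∈ i<mX)
    ρ′∈X : ρ′ ∈ X.B i
    ρ′∈X = subst (ρ′ ∈_) (sym B≡) (Y.leaving∈ i<mY)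
    contra : ρ ≢ ρ′ → ¬ ∃ λ j → i ≤ j × j < Y.m × Y.sep j ≡ X.sep i
    contra ρ≢ρ′ (j , i≤j , j<m , sep≡) with m≤n⇒m<n∨m≡n i≤j
    ... | inj₂ refl = X.leaving∉sep i<mX (subst (ρ ∈_) sep≡ (Y.∈sep i<mY ρ∈Y ρ≢ρ′))
    ... | inj₁ i<j  = Y.leaving∉ i<mY (Y.interval (n≤1+n i) i<j (<⇒≤ j<m) (Y.leaving∈ i<mY) ρ′∈Yj)
      where
      ρ′∈Yj : ρ′ ∈ Y.B j
      ρ′∈Yj = proj₁ (x∈p∩q⁻ _ _ (subst (ρ′ ∈_) (sym sep≡) (X.∈sep i<mX ρ′∈X (ρ≢ρ′ ∘ sym))))

  module _ {i} (i<mX : i < X.m) (i<mY : i < Y.m) (B≡ : X.B i ≡ Y.B i)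
           (ρ≡ : X.leaving i i<mX ≡ Y.leaving i i<mY) where

    private
      q q′ : Fin N
      q = X.entering i i<mX
      q′ = Y.entering i i<mY

      q∉Y : q ≢ q′ → q ∉ Y.B (suc i)
      q∉Y q≢q′ q∈ = X.entering∉ i<mX (subst (q ∈_) (sym B≡) (Y.stayed i<mY q∈ q≢q′))

      q∉Ysep : q ≢ q′ → q ∉ Y.sep (suc i)
      q∉Ysep q≢q′ = q∉Y q≢q′ ∘ proj₁ ∘ x∈p∩q⁻ _ _

      Y-leaving∈X : (1+i<mY : suc i < Y.m) → Y.leaving (suc i) 1+i<mY ∈ X.B (suc i)
      Y-leaving∈X 1+i<mY = TwoChains.next-bag-transfer Y X i<mY i<mX (sym B≡) (sym ρ≡)
                             (Y.leaving∈ 1+i<mY) (Y.leaving≢entering 1+i<mY)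

    entering-agrees-at-end : suc i ≡ X.m → suc i < Y.m → q ≡ q′
    entering-agrees-at-end 1+i≡m 1+i<mY = decidable-stable (q ≟ q′) contra
      where
      s : Fin N
      s = Y.leaving (suc i) 1+i<mY
      q∈Y : q ∈ Y.B Y.m
      q∈Y = subst (_∈ Y.B Y.m) (trans (sym same-end) (sym (X.entering-last i<mX 1+i≡m))) Y.end∈
      contra : q ≢ q′ → ⊥
      contra q≢q′ = Y-separation 1+i<mY ≤-refl 1+i<mY ≤-refl (Y.leaving∈ 1+i<mY) q∈Y
                      (step (Y.leaving∉sep 1+i<mY) s~q (here (q∉Ysep q≢q′)))
        where
        s~q : Adj U s q
        s~q = X.clique (suc i) (Y-leaving∈X 1+i<mY) (X.entering∈ i<mX)
                λ s≡q → q∉Y q≢q′ (subst (_∈ Y.B (suc i)) s≡q (Y.leaving∈ 1+i<mY))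

    entering-agrees-inside : suc i < X.m → suc i < Y.m → q ≡ q′
    entering-agrees-inside 1+i<mX 1+i<mY = decidable-stable (q ≟ q′) λ q≢q′ →
      X-sep-in-Y 1+i<mX (X.leaving∈ 1+i<mX) (X.leaving∉sep 1+i<mX) (<⇒≤ 1+i<mY) s∈Y (contra q≢q′)
      where
      s : Fin N
      s = X.leaving (suc i) 1+i<mX
      s∈Y : s ∈ Y.B (suc i)
      s∈Y = next-bag-transfer i<mX i<mY B≡ ρ≡ (X.leaving∈ 1+i<mX) (X.leaving≢entering 1+i<mX)
      q∈Xsep : q ∈ X.sep (suc i)
      q∈Xsep = X.∈sep 1+i<mX (X.entering∈ i<mX) (X.leaving≢entering 1+i<mX ∘ sym)
      contra : q ≢ q′ → ¬ ∃ λ j → suc i ≤ j × j < Y.m × Y.sep j ≡ X.sep (suc i)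
      contra q≢q′ (j , 1+i≤j , j<m , sep≡) with m≤n⇒m<n∨m≡n 1+i≤j | Y.leaving (suc i) 1+i<mY ≟ s
      ... | inj₂ refl  | _        = q∉Ysep q≢q′ (subst (q ∈_) (sym sep≡) q∈Xsep)
      ... | inj₁ 1+i<j | yes s′≡s =
        Y-separation 1+i<mY ≤-refl 1+i<j (<⇒≤ j<m) s∈Y (proj₁ (x∈p∩q⁻ _ _ (subst (q ∈_) (sym sep≡) q∈Xsep)))
          (step (subst (_∉ Y.sep (suc i)) s′≡s (Y.leaving∉sep 1+i<mY))
                (X.clique (suc i) (X.leaving∈ 1+i<mX) (X.entering∈ i<mX) (X.leaving≢entering 1+i<mX))
                (here (q∉Ysep q≢q′)))
      ... | inj₁ 1+i<j | no s′≢s  =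
        Y.leaving∉ 1+i<mY (Y.interval (n≤1+n _) 1+i<j (<⇒≤ j<m) (Y.leaving∈ 1+i<mY)
          (proj₁ (x∈p∩q⁻ _ _ (subst (_ ∈_) (sym sep≡) (X.∈sep 1+i<mX (Y-leaving∈X 1+i<mY) s′≢s)))))

same-ends⇒same-chain : ∀ {N k} {U : Graph N} → TreeDecomposition U k → (X Y : CliqueChain U k) →
  ChainProperties.start X ≡ ChainProperties.start Y → ChainProperties.end X ≡ ChainProperties.end Y →
  CliqueChain.m X ≡ CliqueChain.m Y × (∀ i → i ≤ CliqueChain.m X → CliqueChain.B X i ≡ CliqueChain.B Y i)
same-ends⇒same-chain TD X Y same-start same-end = m≡ , λ i i≤m → bags-agree i≤m (subst (i ≤_) m≡ i≤m)
  where
  open TwoChains X Y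
  module XY = SameEnds TD X Y same-start same-end
  module YX = SameEnds TD Y X (sym same-start) (sym same-end)

  bags-agree : ∀ {i} → i ≤ X.m → i ≤ Y.m → X.B i ≡ Y.B i
  bags-agree {zero}  _    _    = XY.first-bags-agree
  bags-agree {suc i} i<mX i<mY =
    ⊆-antisym (next-bag⊆ i<mX i<mY B≡ ρ≡ q≡) (TwoChains.next-bag⊆ Y X i<mY i<mX (sym B≡) (sym ρ≡) (sym q≡))
    where
    B≡ : X.B i ≡ Y.B i
    B≡ = bags-agree (<⇒≤ i<mX) (<⇒≤ i<mY)
    ρ≡ : X.leaving i i<mX ≡ Y.leaving i i<mY
    ρ≡ = XY.leaving-agrees i<mX i<mY B≡
    q≡ : X.entering i i<mX ≡ Y.entering i i<mY
    q≡ with m≤n⇒m<n∨m≡n i<mX | m≤n⇒m<n∨m≡n i<mY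
    ... | inj₂ 1+i≡mX | inj₂ 1+i≡mY =
      trans (X.entering-last i<mX 1+i≡mX) (trans same-end (sym (Y.entering-last i<mY 1+i≡mY)))
    ... | inj₂ 1+i≡mX | inj₁ 1+i<mY = XY.entering-agrees-at-end i<mX i<mY B≡ ρ≡ 1+i≡mX 1+i<mY
    ... | inj₁ 1+i<mX | inj₂ 1+i≡mY = sym (YX.entering-agrees-at-end i<mY i<mX (sym B≡) (sym ρ≡) 1+i≡mY 1+i<mX)
    ... | inj₁ 1+i<mX | inj₁ 1+i<mY = XY.entering-agrees-inside i<mX i<mY B≡ ρ≡ 1+i<mX 1+i<mY

  m≡ : X.m ≡ Y.m
  m≡ with <-cmp X.m Y.m
  ... | tri≈ _ mX≡mY _ = mX≡mY
  ... | tri< mX<mY _ _ = ⊥-elim (Y.end∉ mX<mY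
          (subst (_∈ Y.B X.m) same-end (subst (X.end ∈_) (bags-agree ≤-refl (<⇒≤ mX<mY)) X.end∈)))
  ... | tri> _ _ mY<mX = ⊥-elim (X.end∉ mY<mX
          (subst (_∈ X.B Y.m) (sym same-end) (subst (Y.end ∈_) (sym (bags-agree (<⇒≤ mY<mX) ≤-refl)) Y.end∈)))

module _ {A : Set} where

  atℕ : ∀ {m} → (Fin m → A) → A → ℕ → A
  atℕ {zero}  _ d _       = d
  atℕ {suc m} f d zero    = f zero
  atℕ {suc m} f d (suc i) = atℕ (f ∘ suc) d i

  atℕ-toℕ : ∀ {m} (f : Fin m → A) d (j : Fin m) → atℕ f d (toℕ j) ≡ f j
  atℕ-toℕ f d zero    = refl
  atℕ-toℕ f d (suc j) = atℕ-toℕ (f ∘ suc) d j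

  atℕ-elim : (P : A → Set) → ∀ {m} {f : Fin m → A} {d} → P d → (∀ j → P (f j)) → ∀ i → P (atℕ f d i)
  atℕ-elim P {zero}  Pd _  _       = Pd
  atℕ-elim P {suc m} _  Pf zero    = Pf zero
  atℕ-elim P {suc m} Pd Pf (suc i) = atℕ-elim P Pd (Pf ∘ suc) i

module SimpleKPathChain {n k : ℕ} {G : Graph n} (D : SimpleKPathDecomposition k G) where
  open SimpleKPathDecomposition D

  bagℕ : ℕ → Subset n
  bagℕ = atℕ X ∅

  bagℕ-toℕ : ∀ j → bagℕ (toℕ j) ≡ X j
  bagℕ-toℕ = atℕ-toℕ X ∅

  bagℕ-clique : ∀ i → IsClique G (bagℕ i)
  bagℕ-clique = atℕ-elim (IsClique G) (λ u∈∅ → ⊥-elim (∉⊥ u∈∅)) (λ j u∈ v∈ → clique j _ _ u∈ v∈)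

  covers : ∀ u → ∃ λ i → i ≤ m × u ∈ bagℕ i
  covers u = let j , u∈ = cover u in toℕ j , toℕ≤pred[n] j , subst (u ∈_) (sym (bagℕ-toℕ j)) u∈

  spans : ∀ {u v} → Adj G u v → ∃ λ i → i ≤ m × u ∈ bagℕ i × v ∈ bagℕ i
  spans {u} {v} u~v = let j , u∈ , v∈ = edge u v u~v in
    toℕ j , toℕ≤pred[n] j , subst (u ∈_) (sym (bagℕ-toℕ j)) u∈ , subst (v ∈_) (sym (bagℕ-toℕ j)) v∈

  private
    index≤ : ∀ {i} → i ≤ m → ∃ λ (j : Fin (suc m)) → toℕ j ≡ i
    index≤ i≤m = fromℕ< (s≤s i≤m) , toℕ-fromℕ< (s≤s i≤m)

    index< : ∀ {i} → i < m → ∃ λ (j : Fin m) → toℕ j ≡ i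
    index< i<m = fromℕ< i<m , toℕ-fromℕ< i<m

    sepℕ : (j : Fin m) → bagℕ (toℕ j) ∩ bagℕ (suc (toℕ j)) ≡ X (inject₁ j) ∩ X (suc j)
    sepℕ j = cong₂ _∩_ (trans (cong bagℕ (sym (toℕ-inject₁ j))) (bagℕ-toℕ (inject₁ j))) (bagℕ-toℕ (suc j))

    size′ : ∀ {i} → i ≤ m → ∣ bagℕ i ∣ ≡ suc k
    size′ i≤m with index≤ i≤m
    ... | j , refl = trans (cong ∣_∣ (bagℕ-toℕ j)) (size j)

    meet′ : ∀ {i} → i < m → ∣ bagℕ i ∩ bagℕ (suc i) ∣ ≡ k
    meet′ i<m with index< i<m
    ... | j , refl = trans (cong ∣_∣ (sepℕ j)) (meet j)

    distinct′ : ∀ {i j} → i < m → j < m → bagℕ i ∩ bagℕ (suc i) ≡ bagℕ j ∩ bagℕ (suc j) → i ≡ j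
    distinct′ i<m j<m eq with index< i<m | index< j<m
    ... | i′ , refl | j′ , refl = cong toℕ (distinct i′ j′ (trans (sym (sepℕ i′)) (trans eq (sepℕ j′))))

    interval′ : ∀ {v i j l} → i ≤ j → j ≤ l → l ≤ m → v ∈ bagℕ i → v ∈ bagℕ l → v ∈ bagℕ j
    interval′ {v} i≤j j≤l l≤m v∈i v∈l
      with index≤ (≤-trans i≤j (≤-trans j≤l l≤m)) | index≤ (≤-trans j≤l l≤m) | index≤ l≤m
    ... | i′ , refl | j′ , refl | l′ , refl =
      subst (v ∈_) (sym (bagℕ-toℕ j′))
        (interval v i′ j′ l′ i≤j j≤l (subst (v ∈_) (bagℕ-toℕ i′) v∈i) (subst (v ∈_) (bagℕ-toℕ l′) v∈l))

    all-in-first-bag : m ≡ 0 → ∀ u → u ∈ X zero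
    all-in-first-bag m≡0 u = let j , u∈ = cover u in
      subst (λ j → u ∈ X j) (toℕ-injective (n≤0⇒n≡0 (subst (toℕ j ≤_) m≡0 (toℕ≤pred[n] j)))) u∈

  nontrivial : suc k < n → 0 < m
  nontrivial k+1<n = n≢0⇒n>0 λ m≡0 → <-irrefl refl (<-≤-trans k+1<n (n≤1+k m≡0))
    where
    n≤1+k : m ≡ 0 → n ≤ suc k
    n≤1+k m≡0 = subst₂ _≤_ (∣⊤∣≡n n) (size zero)
                  (p⊆q⇒∣p∣≤∣q∣ {p = Data.Fin.Subset.⊤} λ {u} _ → all-in-first-bag m≡0 u)

  chain : suc k < n → CliqueChain G k
  chain k+1<n = record
    { m = m ; B = bagℕ ; size = size′ ; meet = meet′ ; distinct = distinct′ ; interval = interval′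
    ; clique = bagℕ-clique ; nontrivial = nontrivial k+1<n }

module _ {n N k : ℕ} {G : Graph n} {U : Graph N} (emb : ContainsSubgraph U G) where

  private
    f : Fin n → Fin N
    f = proj₁ emb
    f-inj : Injective _≡_ _≡_ f
    f-inj = proj₁ (proj₂ emb)
    f-hom : ∀ u v → Adj G u v → Adj U (f u) (f v)
    f-hom = proj₂ (proj₂ emb)

  image-clique : ∀ {K} → IsClique G K → IsClique U (image f K)
  image-clique {K} K-clique u∈ v∈ u≢v with image⁻ f K u∈ | image⁻ f K v∈
  ... | u₀ , u₀∈ , refl | v₀ , v₀∈ , refl = f-hom u₀ v₀ (K-clique u₀∈ v₀∈ (u≢v ∘ cong f))

  mapChain : CliqueChain G k → CliqueChain U k
  mapChain C = record
    { m          = m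
    ; B          = image f ∘ B
    ; size       = λ {i} i≤m → trans (∣image∣ f-inj (B i)) (size i≤m)
    ; meet       = λ {i} i<m →
                     trans (cong ∣_∣ (sym (image-sep i))) (trans (∣image∣ f-inj (B i ∩ B (suc i))) (meet i<m))
    ; distinct   = λ {i} {j} i<m j<m eq →
                     distinct i<m j<m (image-injective f-inj (trans (image-sep i) (trans eq (sym (image-sep j)))))
    ; interval   = interval′
    ; clique     = image-clique ∘ clique
    ; nontrivial = nontrivial
    }
    where
    open CliqueChain C
    image-sep : ∀ i → image f (B i ∩ B (suc i)) ≡ image f (B i) ∩ image f (B (suc i))
    image-sep i = image-∩ f-inj (B i) (B (suc i))
    interval′ : ∀ {v i j l} → i ≤ j → j ≤ l → l ≤ m → v ∈ image f (B i) → v ∈ image f (B l) → v ∈ image f (B j)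
    interval′ {i = i} {l = l} i≤j j≤l l≤m v∈i v∈l with image⁻ f (B i) v∈i | image⁻ f (B l) v∈l
    ... | u , u∈i , refl | u′ , u′∈l , fu′≡fu =
      image⁺ f (interval i≤j j≤l l≤m u∈i (subst (_∈ B l) (f-inj fu′≡fu) u′∈l))

module Transfer {n N k : ℕ} {G H : Graph n} (D : SimpleKPathDecomposition k G) (E : SimpleKPathDecomposition k H)
                {f g : Fin n → Fin N} (f-inj : Injective _≡_ _≡_ f) (g-inj : Injective _≡_ _≡_ g)
                (images⊆ : ∀ i → i ≤ SimpleKPathDecomposition.m D →
                           image f (SimpleKPathChain.bagℕ D i) ⊆ image g (SimpleKPathChain.bagℕ E i)) where
  module D = SimpleKPathChain D
  module E = SimpleKPathChain E

  private
    lift : ∀ u → ∃ λ u′ → u′ ∈ E.bagℕ (proj₁ (D.covers u)) × g u′ ≡ f u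
    lift u = let i , i≤m , u∈ = D.covers u in image⁻ g _ (images⊆ i i≤m (image⁺ f u∈))

  φ : Fin n → Fin n
  φ u = proj₁ (lift u)

  g∘φ : ∀ u → g (φ u) ≡ f u
  g∘φ u = proj₂ (proj₂ (lift u))

  φ-∈ : ∀ {i u} → i ≤ SimpleKPathDecomposition.m D → u ∈ D.bagℕ i → φ u ∈ E.bagℕ i
  φ-∈ {u = u} i≤m u∈ = image-reflects-∈ g-inj _ (subst (_∈ _) (sym (g∘φ u)) (images⊆ _ i≤m (image⁺ f u∈)))

  φ-hom : ∀ {u v} → Adj G u v → Adj H (φ u) (φ v)
  φ-hom {u} {v} u~v = let i , i≤m , u∈ , v∈ = D.spans u~v in
    E.bagℕ-clique i (φ-∈ i≤m u∈) (φ-∈ i≤m v∈) λ φu≡φv →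
      Adj-irrefl G u~v (f-inj (trans (sym (g∘φ u)) (trans (cong g φu≡φv) (g∘φ v))))

equal-images⇒isomorphic :
  ∀ {n N k} {G H : Graph n} (D : SimpleKPathDecomposition k G) (E : SimpleKPathDecomposition k H) →
  ∀ {f g : Fin n → Fin N} → Injective _≡_ _≡_ f → Injective _≡_ _≡_ g →
  SimpleKPathDecomposition.m D ≡ SimpleKPathDecomposition.m E →
  (∀ i → i ≤ SimpleKPathDecomposition.m D →
         image f (SimpleKPathChain.bagℕ D i) ≡ image g (SimpleKPathChain.bagℕ E i)) →
  Isomorphic G H
equal-images⇒isomorphic {G = G} {H} D E {f} {g} f-inj g-inj m≡ images≡ =
  DE.φ , inverseᵇ⇒bijective (strictlyInverseˡ⇒inverseˡ DE.φ φ∘ψ , strictlyInverseʳ⇒inverseʳ DE.φ ψ∘φ) , adj≡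
  where
  module DE = Transfer D E f-inj g-inj (λ i i≤m → subst (_ ∈_) (images≡ i i≤m))
  module ED = Transfer E D g-inj f-inj (λ i i≤m → subst (_ ∈_) (sym (images≡ i (subst (i ≤_) (sym m≡) i≤m))))
  φ∘ψ : ∀ y → DE.φ (ED.φ y) ≡ y
  φ∘ψ y = g-inj (trans (DE.g∘φ (ED.φ y)) (ED.g∘φ y))
  ψ∘φ : ∀ u → ED.φ (DE.φ u) ≡ u
  ψ∘φ u = f-inj (trans (ED.g∘φ (DE.φ u)) (DE.g∘φ u))
  adj≡ : ∀ u v → adj G u v ≡ adj H (DE.φ u) (DE.φ v)
  adj≡ u v = ⇔→≡ {z = true} (mk⇔ DE.φ-hom λ a → subst₂ (Adj G) (ψ∘φ u) (ψ∘φ v) (ED.φ-hom a))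

module _ {n N k : ℕ} {U : Graph N} (k+1<n : suc k < n) where

  embeddedChain : ∀ {G : Graph n} → SimpleKPathDecomposition k G → ContainsSubgraph U G → CliqueChain U k
  embeddedChain D emb = mapChain emb (SimpleKPathChain.chain D k+1<n)

  endpoints : ∀ {G : Graph n} → SimpleKPathDecomposition k G → ContainsSubgraph U G → Fin (N * N)
  endpoints D emb = let open ChainProperties (embeddedChain D emb) in combine start end

  same-endpoints⇒isomorphic : TreeDecomposition U k → ∀ {G H : Graph n} →
    (D : SimpleKPathDecomposition k G) (emb : ContainsSubgraph U G) →
    (E : SimpleKPathDecomposition k H) (emb′ : ContainsSubgraph U H) →
    endpoints D emb ≡ endpoints E emb′ → Isomorphic G H
  same-endpoints⇒isomorphic TD D emb E emb′ same =
    let same-start , same-end = combine-injective X.start X.end Y.start Y.end same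
        m≡ , B≡ = same-ends⇒same-chain TD (embeddedChain D emb) (embeddedChain E emb′) same-start same-end
    in equal-images⇒isomorphic D E (proj₁ (proj₂ emb)) (proj₁ (proj₂ emb′)) m≡ B≡
    where
    module X = ChainProperties (embeddedChain D emb)
    module Y = ChainProperties (embeddedChain E emb′)

AllPairs-lookup : ∀ {A : Set} {R : A → A → Set} {xs} → AllPairs R xs →
                  ∀ {i j : Fin (length xs)} → i <ᶠ j → R (lookup xs i) (lookup xs j)
AllPairs-lookup (Rx ∷ _)  {zero}  {suc j} _         = All.lookup Rx (∈-lookup j)
AllPairs-lookup (_ ∷ Rxs) {suc i} {suc j} (s≤s i<j) = AllPairs-lookup Rxs i<j

lemma4p3 : (k n N : ℕ) → 2 ≤ k → k + 4 ≤ n →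
           (U : Graph N) → Treewidth U k →
           (S : List (Graph n)) →
           All (IsSimpleKPath k) S →
           AllPairs (λ G H → ¬ Isomorphic G H) S →
           All (ContainsSubgraph U) S →
           length S ≤ N * N
lemma4p3 k n N _ k+4≤n U (TD , _) S paths non-isomorphic embeddings =
  ≮⇒≥ λ N*N<∣S∣ → collision (pigeonhole N*N<∣S∣ key)
  where
  k+1<n : suc k < n
  k+1<n = ≤-trans (≤-reflexive (+-comm 2 k)) (≤-trans (+-monoʳ-≤ k (s≤s (s≤s z≤n))) k+4≤n)
  path : ∀ i → IsSimpleKPath k (lookup S i)
  path i = All.lookup paths (∈-lookup i)
  embedding : ∀ i → ContainsSubgraph U (lookup S i)
  embedding i = All.lookup embeddings (∈-lookup i)
  key : Fin (length S) → Fin (N * N)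
  key i = endpoints {U = U} k+1<n (path i) (embedding i)
  collision : ¬ ∃₂ λ i j → i <ᶠ j × key i ≡ key j
  collision (i , j , i<j , same) = AllPairs-lookup non-isomorphic i<j
    (same-endpoints⇒isomorphic k+1<n TD (path i) (embedding i) (path j) (embedding j) same)
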